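{- Let $D=(V,A)$ be a finite arc-colored Eulerian directed multigraph (finitely many colors) in which every vertex is the head of exactly one arc of each color and the tail of exactly one arc of each color, and let $P$ be a set of pebbles with $|P|=|V|$. Let $\widetilde D$, $p_j$ be as in the context and let $\kappa$ be the number of connected components of $\widetilde D$. Then for every pebble $j\in P$, every arc $a\in A$ and every connected component $\widetilde K$ of $\widetilde D$, \[|p_j^{ -1}(a)\cap A(\widetilde K)|=\frac{(|V|-1)!}{\kappa}.\] In particular this number is independent of $j$, $a$ and $\widetilde K$.
   Context: For each color $c$, $\sigma_c$ is the permutation of $V$ with $\sigma_c(i)=i'$ iff there is an arc of color $c$ from $i$ to $i'$ in $D$. The directed multigraph $\widetilde D=(\widetilde V,\widetilde A)$ has as vertex set the set of bijections $P\to V$, and for each bijection $\eta$ and each color $c$ an arc $(\eta,\sigma_c\circ\eta)$ colored $c$. For $j\in P$, $p_j:\widetilde A\to A$ maps an arc $(\eta,\eta')$ of color $c$ to the arc of $D$ of color $c$ from $\eta(j)$ to $\eta'(j)$. $A(\widetilde K)$ is the arc set of $\widetilde K$. Connected components of $\widetilde D$ (weak and strong coincide since in- and outdegrees are equal). Eulerian: a closed walk traversing every arc exactly once and passing through every vertex. -}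

module Defs where

open import Data.Nat using (ℕ)
open import Data.Fin using (Fin)
open import Data.Vec using (Vec; lookup; map)
open import Data.List using (List; []; _∷_; _++_; length)
open import Data.List.Relation.Unary.Linked using (Linked)
open import Data.List.Relation.Unary.Unique.Propositional using (Unique)
open import Data.List.Membership.Propositional using (_∈_)
open import Data.Product using (Σ; ∃!; _×_; proj₁)
open import Data.Unit using (⊤)
open import Function.Definitions using (Bijective)
open import Relation.Binary.PropositionalEquality using (_≡_)
open import Relation.Binary.Construct.Closure.Equivalence using (EqClosure)

-- A finite arc-colored directed multigraph with vertex set Fin n,
-- color set Fin m and arc set Fin k (arcs are abstract; loops and
-- parallel arcs are allowed).

record ColoredDigraph (n m : ℕ) : Set where
  field
    k    : ℕ
    tail : Fin k → Fin n
    head : Fin k → Fin n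
    col  : Fin k → Fin m

module _ {n m : ℕ} (D : ColoredDigraph n m) where
  open ColoredDigraph D

  OutUnique : Set
  OutUnique = (v : Fin n) (c : Fin m) → ∃! _≡_ (λ a → tail a ≡ v × col a ≡ c)

  InUnique : Set
  InUnique = (v : Fin n) (c : Fin m) → ∃! _≡_ (λ a → head a ≡ v × col a ≡ c)

  -- a list of arcs a₀ … a_{L-1} forms a closed walk:
  -- head aᵢ = tail aᵢ₊₁ and head a_{L-1} = tail a₀
  ClosedWalk : List (Fin k) → Set
  ClosedWalk []       = ⊤
  ClosedWalk (a ∷ ws) = Linked (λ x y → head x ≡ tail y) ((a ∷ ws) ++ (a ∷ []))

  Eulerian : Set
  Eulerian = Σ (List (Fin k)) λ ws →
               ClosedWalk ws
             × Unique ws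
             × ((a : Fin k) → a ∈ ws)
             × ((v : Fin n) → Σ (Fin k) λ a → a ∈ ws × tail a ≡ v)

  module _ (out : OutUnique) where

    outArc : Fin n → Fin m → Fin k
    outArc i c = proj₁ (out i c)

    σ : Fin m → Fin n → Fin n
    σ c i = head (outArc i c)

    -- vertices of D̃: bijections P → V, P = Fin n, a bijection η being
    -- represented by its table (η(j) = lookup η j)
    IsVertex : Vec (Fin n) n → Set
    IsVertex η = Bijective _≡_ _≡_ (lookup η)

    -- arcs of D̃ are pairs (η , c) : the arc (η , σ_c ∘ η) of color c.
    -- One-step adjacency in D̃:
    Step : Vec (Fin n) n → Vec (Fin n) n → Set
    Step η η' = IsVertex η × Σ (Fin m) λ c → η' ≡ map (σ c) η

    -- (weak = strong) connectivity in D̃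
    Conn : Vec (Fin n) n → Vec (Fin n) n → Set
    Conn = EqClosure Step

    p : Fin n → Vec (Fin n) n → Fin m → Fin k
    p j η c = outArc (lookup η j) c

    ComponentCount : ℕ → Set
    ComponentCount κ =
      Σ (Fin κ → Vec (Fin n) n) λ r →
          ((i : Fin κ) → IsVertex (r i))
        × ((i i' : Fin κ) → Conn (r i) (r i') → i ≡ i')
        × ((η : Vec (Fin n) n) → IsVertex η → Σ (Fin κ) λ i → Conn (r i) η)

HasCard : {X : Set} → (X → Set) → ℕ → Set
HasCard {X} P N =
  Σ (List X) λ L →
      Unique L
    × length L ≡ N
    × ((x : X) → x ∈ L → P x)
    × ((x : X) → P x → x ∈ L)

-- Relabelling the pebbles, η ↦ η ∘ π, commutes with the moves η ↦ σ_c ∘ η of D̃, so for vertices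
-- α and β it carries the component of α bijectively onto that of β (take π = α⁻¹ ∘ β).  Hence all
-- κ components have n!/κ vertices.  Inside a component, σ_c carries the vertices with η(j) = v onto
-- those with η(j) = σ_c(v); so the number of such vertices is invariant along the arcs of D and,
-- D being Eulerian, independent of v: it is n!/(κ n).  Finally, the arcs of a component that p_j
-- sends to a are exactly the pairs (η , col a) with η(j) = tail a.

module Submission where

open import Defs
open import Data.Nat using (ℕ; zero; suc; _+_; _*_; _∸_; _!; _≤_; z≤n; s≤s)
open import Data.Nat.Properties
  using (≤-antisym; n<1+n; +-suc; +-0-commutativeMonoid; *-cancelˡ-≡)
open import Data.Fin using (Fin; zero; suc; punchIn; punchOut)
open import Data.Fin.Properties
  using (_≟_; all?; any?; <⇒notInjective; punchInᵢ≢i; punchIn-injective; punchOut-injective; suc-injective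
        ; punchOut-cong; punchOut-punchIn; punchIn-punchOut)
open import Data.Vec using (Vec; []; _∷_; lookup; map)
import Data.Vec as Vec
open import Data.Vec.Properties
  using (∷-injective; lookup-map; map-∘; map-cong; map-id; tabulate∘lookup; tabulate-cong)
open import Data.Vec.Functional using (Vector)
open import Data.List using (List; []; _∷_; _++_; length; filter; allFin; cartesianProduct; cartesianProductWith)
open import Data.List.Properties using (length-++; filter-accept; filter-reject)
open import Data.List.Relation.Unary.Any using (here; there)
open import Data.List.Relation.Unary.All using ([]; _∷_) renaming (lookup to All-lookup)
open import Data.List.Relation.Unary.AllPairs using ([]; _∷_)
open import Data.List.Relation.Unary.Linked using (Linked; _∷_)
open import Data.List.Relation.Unary.Unique.Propositional using (Unique)
import Data.List.Relation.Unary.Unique.Propositional.Properties as Unique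
open import Data.List.Membership.Propositional using (_∈_)
open import Data.List.Membership.Propositional.Properties
  using (∈-∃++; ∈-filter⁺; ∈-filter⁻; ∈-++⁺ˡ; ∈-++⁺ʳ; ∈-++⁻; ∈-allFin
        ; ∈-cartesianProductWith⁺; ∈-cartesianProduct⁺)
open import Data.Product using (Σ; _×_; _,_; proj₁; proj₂)
open import Data.Sum using (inj₁; inj₂)
open import Data.Empty using (⊥-elim)
open import Level using (0ℓ)
open import Relation.Nullary using (Dec; yes; no; contradiction)
open import Relation.Nullary.Decidable using (map′; _→-dec_; _×-dec_)
open import Function.Base using (id)
open import Function.Definitions using (Injective; Surjective; Bijective)
open import Relation.Unary using (Pred; Decidable; _∩_)
open import Relation.Unary.Properties using (_∩?_)
import Relation.Binary.Construct.Closure.Equivalence as EC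
open import Relation.Binary.Construct.Closure.ReflexiveTransitive using (_◅◅_)
open import Relation.Binary.Definitions using (DecidableEquality)
open import Relation.Binary.PropositionalEquality
  using (_≡_; _≢_; refl; sym; trans; cong; cong₂; subst; module ≡-Reasoning)
open import Data.Nat.Tactic.RingSolver using (solve-∀)
open import Algebra.Properties.CommutativeMonoid.Sum +-0-commutativeMonoid
  using (sum; sum-remove; sum-cong-≗; sum-replicate-zero)

record Finite (X : Set) : Set where
  field
    elements        : List X
    elements-unique : Unique elements
    ∈-elements      : (x : X) → x ∈ elements

open Finite

count : {X : Set} {P : Pred X 0ℓ} → Finite X → Decidable P → ℕ
count X P? = length (filter P? (elements X))

length-≤-injectiveOn : {X Y : Set} (f : X → Y) {xs : List X} {ys : List Y} → Unique xs →
  (∀ {x x'} → x ∈ xs → x' ∈ xs → f x ≡ f x' → x ≡ x') →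
  (∀ {x} → x ∈ xs → f x ∈ ys) → length xs ≤ length ys
length-≤-injectiveOn f {[]} _ _ _ = z≤n
length-≤-injectiveOn f {x ∷ xs} (x∉xs ∷ xs-unique) f-inj f-into
  with us , ws , refl ← ∈-∃++ (f-into (here refl)) =
  subst (suc (length xs) ≤_) (length-middle us ws)
    (s≤s (length-≤-injectiveOn f xs-unique (λ p q → f-inj (there p) (there q)) into-rest))
  where
  length-middle : ∀ {A : Set} (us ws : List A) {y : A} →
    suc (length (us ++ ws)) ≡ length (us ++ y ∷ ws)
  length-middle us ws = trans (cong suc (length-++ us))
    (trans (sym (+-suc (length us) (length ws))) (sym (length-++ us)))
  into-rest : ∀ {x'} → x' ∈ xs → f x' ∈ us ++ ws
  into-rest {x'} x'∈xs with ∈-++⁻ us (f-into (there x'∈xs))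
  ... | inj₁ p         = ∈-++⁺ˡ p
  ... | inj₂ (here e)  = ⊥-elim (All-lookup x∉xs x'∈xs (f-inj (here refl) (there x'∈xs) (sym e)))
  ... | inj₂ (there p) = ∈-++⁺ʳ us p

count-≤ : {X Y : Set} (S : Finite X) (T : Finite Y) {P : Pred X 0ℓ} {Q : Pred Y 0ℓ}
  (P? : Decidable P) (Q? : Decidable Q) (f : X → Y) (g : Y → X) →
  (∀ x → P x → Q (f x)) → (∀ x → P x → g (f x) ≡ x) → count S P? ≤ count T Q?
count-≤ S T {P} P? Q? f g f-PQ g∘f≡id = length-≤-injectiveOn f (Unique.filter⁺ P? (elements-unique S))
  (λ p q e → trans (sym (g∘f≡id _ (P-of p))) (trans (cong g e) (g∘f≡id _ (P-of q))))
  (λ {x} p → ∈-filter⁺ Q? (∈-elements T (f x)) (f-PQ x (P-of p)))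
  where
  P-of : ∀ {x} → x ∈ filter P? (elements S) → P x
  P-of p = proj₂ (∈-filter⁻ P? {xs = elements S} p)

count-≡ : {X Y : Set} (S : Finite X) (T : Finite Y) {P : Pred X 0ℓ} {Q : Pred Y 0ℓ}
  (P? : Decidable P) (Q? : Decidable Q) (f : X → Y) (g : Y → X) →
  (∀ x → P x → Q (f x)) → (∀ y → Q y → P (g y)) →
  (∀ x → P x → g (f x) ≡ x) → (∀ y → Q y → f (g y) ≡ y) →
  count S P? ≡ count T Q?
count-≡ S T P? Q? f g f-PQ g-QP g∘f f∘g =
  ≤-antisym (count-≤ S T P? Q? f g f-PQ g∘f) (count-≤ T S Q? P? g f g-QP f∘g)

sum-const : (K c : ℕ) → sum {K} (λ _ → c) ≡ K * c
sum-const zero    c = refl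
sum-const (suc K) c = cong (c +_) (sum-const K c)

sum-suc-at : {K : ℕ} (k : Fin K) (f g : Vector ℕ K) →
  f k ≡ suc (g k) → (∀ i → i ≢ k → f i ≡ g i) → sum f ≡ suc (sum g)
sum-suc-at {suc K} k f g fk≡1+gk f≗g-elsewhere = begin
  sum f                                    ≡⟨ sum-remove f ⟩
  f k + sum (λ i → f (punchIn k i))        ≡⟨ cong₂ _+_ fk≡1+gk (sum-cong-≗ λ i →
                                                f≗g-elsewhere _ (punchInᵢ≢i k i)) ⟩
  suc (g k + sum (λ i → g (punchIn k i)))  ≡⟨ cong suc (sum-remove g) ⟨
  suc (sum g)                              ∎
  where open ≡-Reasoning

module _ {X : Set} {P : Pred X 0ℓ} (P? : Decidable P) {K : ℕ} (h : X → Fin K) where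
  open ≡-Reasoning

  Fibre? : (i : Fin K) → Decidable (P ∩ (λ x → h x ≡ i))
  Fibre? i = P? ∩? (λ x → h x ≟ i)

  sum-length-fibres : (xs : List X) →
    sum (λ i → length (filter (Fibre? i) xs)) ≡ length (filter P? xs)
  sum-length-fibres [] = sum-replicate-zero K
  sum-length-fibres (x ∷ xs) = by-cases (P? x)
    where
    fibre-length : Fin K → List X → ℕ
    fibre-length i ys = length (filter (Fibre? i) ys)
    by-cases : Dec (P x) → sum (λ i → fibre-length i (x ∷ xs)) ≡ length (filter P? (x ∷ xs))
    by-cases (yes p) = begin
      sum (λ i → fibre-length i (x ∷ xs))  ≡⟨ sum-suc-at (h x) _ _
        (cong length (filter-accept (Fibre? (h x)) (p , refl)))
        (λ i i≢hx → cong length (filter-reject (Fibre? i) (λ (_ , e) → i≢hx (sym e)))) ⟩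
      suc (sum (λ i → fibre-length i xs))  ≡⟨ cong suc (sum-length-fibres xs) ⟩
      suc (length (filter P? xs))          ≡⟨ cong length (filter-accept P? p) ⟨
      length (filter P? (x ∷ xs))          ∎
    by-cases (no ¬p) = begin
      sum (λ i → fibre-length i (x ∷ xs))  ≡⟨ sum-cong-≗ (λ i →
        cong length (filter-reject (Fibre? i) (λ (p , _) → ¬p p))) ⟩
      sum (λ i → fibre-length i xs)        ≡⟨ sum-length-fibres xs ⟩
      length (filter P? xs)                ≡⟨ cong length (filter-reject P? ¬p) ⟨
      length (filter P? (x ∷ xs))          ∎

  count-uniform-fibres : (S : Finite X) (c : ℕ) → (∀ i → count S (Fibre? i) ≡ c) → count S P? ≡ K * c
  count-uniform-fibres S c fibre≡c = begin
    count S P?                   ≡⟨ sum-length-fibres (elements S) ⟨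
    sum (λ i → count S (Fibre? i)) ≡⟨ sum-cong-≗ fibre≡c ⟩
    sum {K} (λ _ → c)            ≡⟨ sum-const K c ⟩
    K * c                        ∎

hasCard-count : {X : Set} (S : Finite X) {P Q : Pred X 0ℓ} (Q? : Decidable Q) →
  (∀ x → P x → Q x) → (∀ x → Q x → P x) → HasCard P (count S Q?)
hasCard-count S Q? P⇒Q Q⇒P =
  filter Q? (elements S) , Unique.filter⁺ Q? (elements-unique S) , refl ,
  (λ x x∈ → Q⇒P x (proj₂ (∈-filter⁻ Q? {xs = elements S} x∈))) ,
  (λ x Px → ∈-filter⁺ Q? (∈-elements S x) (P⇒Q x Px))

Finite-Fin : (n : ℕ) → Finite (Fin n)
Finite-Fin n = record { elements = allFin n ; elements-unique = Unique.allFin⁺ n ; ∈-elements = ∈-allFin }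

Finite-Vec : {A : Set} → Finite A → (l : ℕ) → Finite (Vec A l)
Finite-Vec A zero = record
  { elements = [] ∷ [] ; elements-unique = [] ∷ [] ; ∈-elements = λ { [] → here refl } }
Finite-Vec A (suc l) = record
  { elements        = cartesianProductWith _∷_ (elements A) (elements (Finite-Vec A l))
  ; elements-unique = Unique.cartesianProductWith⁺ _∷_ ∷-injective
                        (elements-unique A) (elements-unique (Finite-Vec A l))
  ; ∈-elements      = λ { (x ∷ xs) → ∈-cartesianProductWith⁺ _∷_
                                        (∈-elements A x) (∈-elements (Finite-Vec A l) xs) }
  }

Finite-× : {A B : Set} → Finite A → Finite B → Finite (A × B)
Finite-× A B = record
  { elements        = cartesianProduct (elements A) (elements B)
  ; elements-unique = Unique.cartesianProduct⁺ (elements-unique A) (elements-unique B)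
  ; ∈-elements      = λ (x , y) → ∈-cartesianProduct⁺ (∈-elements A x) (∈-elements B y)
  }

count-×-singleton : {X Y : Set} (S : Finite X) (T : Finite Y) {P : Pred X 0ℓ} (P? : Decidable P)
  (_≟Y_ : DecidableEquality Y) (y₀ : Y) →
  count (Finite-× S T) (λ (x , y) → P? x ×-dec (y ≟Y y₀)) ≡ count S P?
count-×-singleton S T P? _≟Y_ y₀ = count-≡ (Finite-× S T) S _ P? proj₁ (_, y₀)
  (λ _ → proj₁) (λ _ Px → Px , refl) (λ { _ (_ , refl) → refl }) (λ _ _ → refl)

Tables : (n l : ℕ) → Finite (Vec (Fin n) l)
Tables n = Finite-Vec (Finite-Fin n)

-- On Fin n the injective tables are exactly the vertices of D̃ (injective⇒bijective below);
-- injectivity is the form that is decidable and closed under the constructions used here.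
injective? : {n l : ℕ} (η : Vec (Fin n) l) → Dec (Injective _≡_ _≡_ (lookup η))
injective? η = map′ (λ inj {i} {j} → inj i j) (λ inj i j → inj)
  (all? λ i → all? λ j → (lookup η i ≟ lookup η j) →-dec (i ≟ j))

injective⇒surjective : {n : ℕ} {f : Fin n → Fin n} → Injective _≡_ _≡_ f → Surjective _≡_ _≡_ f
injective⇒surjective {suc n} {f} f-injective y with any? (λ x → f x ≟ y)
... | yes (x , fx≡y) = x , λ { refl → fx≡y }
... | no ∄x = ⊥-elim (<⇒notInjective (n<1+n n) punchOut∘f-injective)
  where
  fx≢y : ∀ x → y ≢ f x
  fx≢y x y≡fx = ∄x (x , sym y≡fx)
  punchOut∘f-injective : Injective _≡_ _≡_ (λ x → punchOut (fx≢y x))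
  punchOut∘f-injective e = f-injective (punchOut-injective (fx≢y _) (fx≢y _) e)

injective⇒bijective : {n : ℕ} {f : Fin n → Fin n} → Injective _≡_ _≡_ f → Bijective _≡_ _≡_ f
injective⇒bijective f-injective = f-injective , injective⇒surjective f-injective

punchOut-or : {n : ℕ} → Fin (suc n) → Fin n → Fin (suc n) → Fin n
punchOut-or i d j with i ≟ j
... | yes _   = d
... | no i≢j = punchOut i≢j

punchOut-or-punchIn : {n : ℕ} (i : Fin (suc n)) (d j : Fin n) → punchOut-or i d (punchIn i j) ≡ j
punchOut-or-punchIn i d j with i ≟ punchIn i j
... | yes i≡i↑j = contradiction (sym i≡i↑j) (punchInᵢ≢i i j)
... | no i≢i↑j  = trans (punchOut-cong i refl) (punchOut-punchIn i)

punchIn-punchOut-or : {n : ℕ} (i : Fin (suc n)) (d : Fin n) {j : Fin (suc n)} → i ≢ j →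
  punchIn i (punchOut-or i d j) ≡ j
punchIn-punchOut-or i d {j} i≢j with i ≟ j
... | yes i≡j = contradiction i≡j i≢j
... | no i≢j′ = punchIn-punchOut i≢j′

lookup-extensionality : {A : Set} {l : ℕ} {u v : Vec A l} → (∀ i → lookup u i ≡ lookup v i) → u ≡ v
lookup-extensionality {u = u} {v} u≗v =
  trans (sym (tabulate∘lookup u)) (trans (tabulate-cong u≗v) (tabulate∘lookup v))

map-injective : {A B : Set} {l : ℕ} {f : A → B} (η : Vec A l) →
  Injective _≡_ _≡_ f → Injective _≡_ _≡_ (lookup η) → Injective _≡_ _≡_ (lookup (map f η))
map-injective {f = f} η f-inj η-inj {i} {j} e =
  η-inj (f-inj (trans (sym (lookup-map i f η)) (trans e (lookup-map j f η))))

map-inverse : {A B : Set} {l : ℕ} {f : A → B} {g : B → A} → (∀ x → g (f x) ≡ x) →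
  (η : Vec A l) → map g (map f η) ≡ η
map-inverse g∘f≗id η = trans (sym (map-∘ _ _ η)) (trans (map-cong g∘f≗id η) (map-id η))

injective⇒head∉tail : {A : Set} {l : ℕ} {y : A} {η : Vec A l} →
  Injective _≡_ _≡_ (lookup (y ∷ η)) → ∀ k → y ≢ lookup η k
injective⇒head∉tail η-inj k y≡ηk with () ← η-inj {zero} {suc k} y≡ηk

module _ {n : ℕ} (x : Fin (suc (suc n))) where

  insert : Vec (Fin (suc n)) (suc n) → Vec (Fin (suc (suc n))) (suc (suc n))
  insert ζ = x ∷ map (punchIn x) ζ

  remove : Vec (Fin (suc (suc n))) (suc (suc n)) → Vec (Fin (suc n)) (suc n)
  remove η = map (punchOut-or x zero) (Vec.tail η)

  insert-injective : {ζ : Vec (Fin (suc n)) (suc n)} →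
    Injective _≡_ _≡_ (lookup ζ) → Injective _≡_ _≡_ (lookup (insert ζ))
  insert-injective {ζ} ζ-inj {zero}  {zero}  _ = refl
  insert-injective {ζ} ζ-inj {zero}  {suc j} e =
    contradiction (trans (sym (lookup-map j (punchIn x) ζ)) (sym e)) (punchInᵢ≢i x (lookup ζ j))
  insert-injective {ζ} ζ-inj {suc i} {zero}  e =
    contradiction (trans (sym (lookup-map i (punchIn x) ζ)) e) (punchInᵢ≢i x (lookup ζ i))
  insert-injective {ζ} ζ-inj {suc i} {suc j} e = cong suc (ζ-inj (punchIn-injective x _ _
    (trans (sym (lookup-map i (punchIn x) ζ)) (trans e (lookup-map j (punchIn x) ζ)))))

  remove-injective : {η : Vec (Fin (suc (suc n))) (suc (suc n))} →
    Injective _≡_ _≡_ (lookup η) → Vec.head η ≡ x → Injective _≡_ _≡_ (lookup (remove η))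
  remove-injective {y ∷ η} η-inj refl {i} {j} e = suc-injective (η-inj (begin
    lookup η i                                   ≡⟨ punchIn-punchOut-or y zero (y∉η i) ⟨
    punchIn y (punchOut-or y zero (lookup η i))  ≡⟨ cong (punchIn y) (lookup-map i _ η) ⟨
    punchIn y (lookup (remove (y ∷ η)) i)        ≡⟨ cong (punchIn y) e ⟩
    punchIn y (lookup (remove (y ∷ η)) j)        ≡⟨ cong (punchIn y) (lookup-map j _ η) ⟩
    punchIn y (punchOut-or y zero (lookup η j))  ≡⟨ punchIn-punchOut-or y zero (y∉η j) ⟩
    lookup η j                                   ∎))
    where
    open ≡-Reasoning
    y∉η : ∀ k → y ≢ lookup η k
    y∉η = injective⇒head∉tail η-inj

  remove-insert : (ζ : Vec (Fin (suc n)) (suc n)) → remove (insert ζ) ≡ ζ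
  remove-insert = map-inverse (punchOut-or-punchIn x zero)

  insert-remove : {η : Vec (Fin (suc (suc n))) (suc (suc n))} →
    Injective _≡_ _≡_ (lookup η) → Vec.head η ≡ x → insert (remove η) ≡ η
  insert-remove {y ∷ η} η-inj refl = cong (y ∷_) (lookup-extensionality λ k → begin
    lookup (map (punchIn y) (remove (y ∷ η))) k    ≡⟨ lookup-map k (punchIn y) (remove (y ∷ η)) ⟩
    punchIn y (lookup (remove (y ∷ η)) k)          ≡⟨ cong (punchIn y) (lookup-map k _ η) ⟩
    punchIn y (punchOut-or y zero (lookup η k))    ≡⟨ punchIn-punchOut-or y zero
                                                        (injective⇒head∉tail η-inj k) ⟩
    lookup η k                                     ∎)
    where open ≡-Reasoning

count-injective-head-fibre : {n : ℕ} (x : Fin (suc (suc n))) →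
  count (Tables (suc (suc n)) (suc (suc n))) (Fibre? injective? Vec.head x) ≡
  count (Tables (suc n) (suc n)) injective?
count-injective-head-fibre x = count-≡ (Tables _ _) (Tables _ _) _ _ (remove x) (insert x)
  (λ η (η-inj , head≡x) → remove-injective x {η} η-inj head≡x)
  (λ ζ ζ-inj → insert-injective x {ζ} ζ-inj , refl)
  (λ η (η-inj , head≡x) → insert-remove x {η} η-inj head≡x)
  (λ ζ _ → remove-insert x ζ)

count-injective : (n : ℕ) → count (Tables n n) injective? ≡ n !
count-injective 0 = refl
count-injective 1 = refl  -- `remove` needs a default value, so this case is computed
count-injective (suc (suc n)) =
  count-uniform-fibres injective? Vec.head (Tables (suc (suc n)) (suc (suc n))) (suc n !)
  (λ x → trans (count-injective-head-fibre x) (count-injective (suc n)))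

infixl 5 _⊙_
_⊙_ : {n l k : ℕ} → Vec (Fin n) l → Vec (Fin l) k → Vec (Fin n) k
η ⊙ π = map (lookup η) π

module _ {n l k : ℕ} (η : Vec (Fin n) l) (π : Vec (Fin l) k) where

  ⊙-injective : Injective _≡_ _≡_ (lookup η) → Injective _≡_ _≡_ (lookup π) →
                Injective _≡_ _≡_ (lookup (η ⊙ π))
  ⊙-injective η-inj π-inj {i} {j} e =
    π-inj (η-inj (trans (sym (lookup-map i (lookup η) π)) (trans e (lookup-map j (lookup η) π))))

  ⊙-injectiveʳ : Injective _≡_ _≡_ (lookup (η ⊙ π)) → Injective _≡_ _≡_ (lookup π)
  ⊙-injectiveʳ ηπ-inj {i} {j} e =
    ηπ-inj (trans (lookup-map i (lookup η) π) (trans (cong (lookup η) e) (sym (lookup-map j (lookup η) π))))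

  map-⊙ : (f : Fin n → Fin n) → map f (η ⊙ π) ≡ map f η ⊙ π
  map-⊙ f = trans (sym (map-∘ f (lookup η) π)) (map-cong (λ i → sym (lookup-map i f η)) π)

module _ {n : ℕ} (α : Vec (Fin n) n) (α-inj : Injective _≡_ _≡_ (lookup α)) where

  relabelling : {l : ℕ} → Vec (Fin n) l → Vec (Fin n) l
  relabelling β = map (λ v → proj₁ (injective⇒surjective α-inj v)) β

  ⊙-relabelling : {l : ℕ} (β : Vec (Fin n) l) → α ⊙ relabelling β ≡ β
  ⊙-relabelling β = begin
    map (lookup α) (map _ β)  ≡⟨ map-∘ _ _ β ⟨
    map _ β                   ≡⟨ map-cong (λ v → proj₂ (injective⇒surjective α-inj v) refl) β ⟩
    map id β                  ≡⟨ map-id β ⟩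
    β                         ∎
    where open ≡-Reasoning

  ⊙-cancel : {β : Vec (Fin n) n} {π π′ : Vec (Fin n) n} → α ⊙ π ≡ β → β ⊙ π′ ≡ α →
             (η : Vec (Fin n) n) → η ⊙ π ⊙ π′ ≡ η
  ⊙-cancel {β} {π} {π′} απ≡β βπ′≡α η = lookup-extensionality λ k → begin
    lookup (η ⊙ π ⊙ π′) k            ≡⟨ lookup-map k _ π′ ⟩
    lookup (η ⊙ π) (lookup π′ k)     ≡⟨ lookup-map (lookup π′ k) _ π ⟩
    lookup η (lookup π (lookup π′ k)) ≡⟨ cong (lookup η) (α-inj (begin
      lookup α (lookup π (lookup π′ k)) ≡⟨ lookup-map (lookup π′ k) (lookup α) π ⟨
      lookup (α ⊙ π) (lookup π′ k)      ≡⟨ cong (λ γ → lookup γ (lookup π′ k)) απ≡β ⟩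
      lookup β (lookup π′ k)            ≡⟨ lookup-map k (lookup β) π′ ⟨
      lookup (β ⊙ π′) k                 ≡⟨ cong (λ γ → lookup γ k) βπ′≡α ⟩
      lookup α k                        ∎)) ⟩
    lookup η k                        ∎
    where open ≡-Reasoning

module _ {n m : ℕ} (D : ColoredDigraph n m) where
  open ColoredDigraph D

  ArcInvariant : {X : Set} → (Fin n → X) → Set
  ArcInvariant f = ∀ b → f (tail b) ≡ f (head b)

  linked-arc-invariant : {X : Set} (f : Fin n → X) → ArcInvariant f →
    ∀ {b bs} → Linked (λ x y → head x ≡ tail y) (b ∷ bs) →
    ∀ {b′} → b′ ∈ bs → f (tail b′) ≡ f (tail b)
  linked-arc-invariant f f-inv {b} (hb≡tb′ ∷ _) (here refl) = sym (trans (f-inv b) (cong f hb≡tb′))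
  linked-arc-invariant f f-inv {b} (hb≡tb′ ∷ linked) (there b′∈bs) =
    trans (linked-arc-invariant f f-inv linked b′∈bs)
          (linked-arc-invariant f f-inv (hb≡tb′ ∷ linked) (here refl))

  eulerian⇒arc-invariant-constant : Eulerian D → {X : Set} (f : Fin n → X) → ArcInvariant f →
    ∀ v v′ → f v ≡ f v′
  eulerian⇒arc-invariant-constant ([] , _ , _ , _ , visits) f f-inv v v′
    with () ← proj₁ (proj₂ (visits v))
  eulerian⇒arc-invariant-constant (b₀ ∷ bs , closed , _ , _ , visits) f f-inv v v′ =
    trans (≡f-tail-b₀ v) (sym (≡f-tail-b₀ v′))
    where
    ≡f-tail-b₀ : ∀ w → f w ≡ f (tail b₀)
    ≡f-tail-b₀ w with visits w
    ... | b , here refl  , refl = refl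
    ... | b , there b∈bs , refl = linked-arc-invariant f f-inv closed (∈-++⁺ˡ b∈bs)

module _ {n m : ℕ} (D : ColoredDigraph n m) (out : OutUnique D) (in′ : InUnique D) where
  open ColoredDigraph D

  private
    arcIn : Fin n → Fin m → Fin k
    arcIn v c = proj₁ (in′ v c)

  outArc-unique : ∀ {v c b} → tail b ≡ v → col b ≡ c → outArc D out v c ≡ b
  outArc-unique {v} {c} tb≡v cb≡c = proj₂ (proj₂ (out v c)) (tb≡v , cb≡c)

  outArc-tail : ∀ v c → tail (outArc D out v c) ≡ v
  outArc-tail v c = proj₁ (proj₁ (proj₂ (out v c)))

  outArc-col : ∀ v c → col (outArc D out v c) ≡ c
  outArc-col v c = proj₂ (proj₁ (proj₂ (out v c)))

  head≡σ-tail : ∀ b → head b ≡ σ D out (col b) (tail b)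
  head≡σ-tail b = cong head (sym (outArc-unique refl refl))

  σ⁻¹ : Fin m → Fin n → Fin n
  σ⁻¹ c v = tail (arcIn v c)

  σ-σ⁻¹ : ∀ c v → σ D out c (σ⁻¹ c v) ≡ v
  σ-σ⁻¹ c v = trans (cong head (outArc-unique refl (proj₂ (proj₁ (proj₂ (in′ v c))))))
                    (proj₁ (proj₁ (proj₂ (in′ v c))))

  σ⁻¹-σ : ∀ c v → σ⁻¹ c (σ D out c v) ≡ v
  σ⁻¹-σ c v = trans
    (cong tail (proj₂ (proj₂ (in′ (σ D out c v) c)) {outArc D out v c} (refl , outArc-col v c)))
    (outArc-tail v c)

  σ-injective : ∀ c → Injective _≡_ _≡_ (σ D out c)
  σ-injective c {v} {v′} e = trans (sym (σ⁻¹-σ c v)) (trans (cong (σ⁻¹ c) e) (σ⁻¹-σ c v′))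

  σ⁻¹-injective : ∀ c → Injective _≡_ _≡_ (σ⁻¹ c)
  σ⁻¹-injective c {v} {v′} e = trans (sym (σ-σ⁻¹ c v)) (trans (cong (σ D out c) e) (σ-σ⁻¹ c v′))

  Conn-σ : ∀ c η → Injective _≡_ _≡_ (lookup η) → Conn D out η (map (σ D out c) η)
  Conn-σ c η η-inj = EC.return (injective⇒bijective η-inj , c , refl)

  Conn-σ⁻¹ : ∀ c η → Injective _≡_ _≡_ (lookup η) → Conn D out η (map (σ⁻¹ c) η)
  Conn-σ⁻¹ c η η-inj = EC.symmetric _ (subst (Conn D out (map (σ⁻¹ c) η)) (map-inverse (σ-σ⁻¹ c) η)
    (Conn-σ c _ (map-injective η (σ⁻¹-injective c) η-inj)))

  Conn-⊙ : {π : Vec (Fin n) n} → Injective _≡_ _≡_ (lookup π) →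
           ∀ {η η′} → Conn D out η η′ → Conn D out (η ⊙ π) (η′ ⊙ π)
  Conn-⊙ {π} π-inj = EC.gmap (_⊙ π) λ {η} → λ { (η-vertex , c , refl) →
    injective⇒bijective (⊙-injective η π (proj₁ η-vertex) π-inj) , c , sym (map-⊙ η π (σ D out c)) }

  -- Only the value of `component` on vertices matters; `junk` is its value on other tables.
  module Components {κ : ℕ} (components : ComponentCount D out κ) (junk : Fin κ) where

    private
      rep : Fin κ → Vec (Fin n) n
      rep = proj₁ components

      rep-injective : ∀ i → Injective _≡_ _≡_ (lookup (rep i))
      rep-injective i = proj₁ (proj₁ (proj₂ components) i)

      rep-separated : ∀ i i′ → Conn D out (rep i) (rep i′) → i ≡ i′
      rep-separated = proj₁ (proj₂ (proj₂ components))

      rep-covers : ∀ η → IsVertex D out η → Σ (Fin κ) λ i → Conn D out (rep i) η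
      rep-covers = proj₂ (proj₂ (proj₂ components))

    component : Vec (Fin n) n → Fin κ
    component η with injective? η
    ... | yes η-inj = proj₁ (rep-covers η (injective⇒bijective η-inj))
    ... | no _      = junk

    Conn-rep-component : ∀ η → Injective _≡_ _≡_ (lookup η) → Conn D out (rep (component η)) η
    Conn-rep-component η η-inj with injective? η
    ... | yes η-inj′ = proj₂ (rep-covers η (injective⇒bijective η-inj′))
    ... | no ¬η-inj  = ⊥-elim (¬η-inj η-inj)

    component-unique : ∀ {i} η → Injective _≡_ _≡_ (lookup η) → Conn D out (rep i) η →
                       component η ≡ i
    component-unique η η-inj rep→η =
      rep-separated _ _ (Conn-rep-component η η-inj ◅◅ EC.symmetric _ rep→η)

    InComponent : Fin κ → Pred (Vec (Fin n) n) 0ℓ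
    InComponent i = (λ η → Injective _≡_ _≡_ (lookup η)) ∩ (λ η → component η ≡ i)

    inComponent? : ∀ i → Decidable (InComponent i)
    inComponent? = Fibre? injective? component

    InComponent⇒Conn-rep : ∀ {i} η → InComponent i η → Conn D out (rep i) η
    InComponent⇒Conn-rep η (η-inj , refl) = Conn-rep-component η η-inj

    InComponent-resp-Conn : ∀ {i} η η′ → Injective _≡_ _≡_ (lookup η′) → Conn D out η η′ →
                       InComponent i η → InComponent i η′
    InComponent-resp-Conn η η′ η′-inj η→η′ η∈i =
      η′-inj , component-unique η′ η′-inj (InComponent⇒Conn-rep η η∈i ◅◅ η→η′)

    relabeller : Fin κ → Fin κ → Vec (Fin n) n
    relabeller i i′ = relabelling (rep i) (rep-injective i) (rep i′)

    rep-⊙-relabeller : ∀ i i′ → rep i ⊙ relabeller i i′ ≡ rep i′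
    rep-⊙-relabeller i i′ = ⊙-relabelling (rep i) (rep-injective i) (rep i′)

    relabel-InComponent : ∀ i i′ η → InComponent i η → InComponent i′ (η ⊙ relabeller i i′)
    relabel-InComponent i i′ η (η-inj , refl) = ηπ-inj , component-unique (η ⊙ π) ηπ-inj
      (subst (λ γ → Conn D out γ (η ⊙ π)) (rep-⊙-relabeller i i′)
        (Conn-⊙ π-inj (Conn-rep-component η η-inj)))
      where
      π = relabeller i i′
      π-inj : Injective _≡_ _≡_ (lookup π)
      π-inj = ⊙-injectiveʳ (rep i) π
        (subst (λ γ → Injective _≡_ _≡_ (lookup γ)) (sym (rep-⊙-relabeller i i′)) (rep-injective i′))
      ηπ-inj : Injective _≡_ _≡_ (lookup (η ⊙ π))
      ηπ-inj = ⊙-injective η π η-inj π-inj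

    count-InComponent-uniform : ∀ i i′ →
      count (Tables n n) (inComponent? i) ≡ count (Tables n n) (inComponent? i′)
    count-InComponent-uniform i i′ =
      count-≡ (Tables n n) (Tables n n) (inComponent? i) (inComponent? i′)
        (_⊙ relabeller i i′) (_⊙ relabeller i′ i)
        (relabel-InComponent i i′) (relabel-InComponent i′ i)
        (λ η _ → ⊙-cancel (rep i) (rep-injective i) (rep-⊙-relabeller i i′) (rep-⊙-relabeller i′ i) η)
        (λ η _ → ⊙-cancel (rep i′) (rep-injective i′) (rep-⊙-relabeller i′ i) (rep-⊙-relabeller i i′) η)

    κ*count-InComponent≡n! : ∀ i → κ * count (Tables n n) (inComponent? i) ≡ n !
    κ*count-InComponent≡n! i = trans
      (sym (count-uniform-fibres injective? component (Tables n n) _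
             (λ i′ → count-InComponent-uniform i′ i)))
      (count-injective n)

    module _ (j : Fin n) where

      pebbleFibre? : ∀ i v → Decidable (InComponent i ∩ (λ η → lookup η j ≡ v))
      pebbleFibre? i = Fibre? (inComponent? i) (λ η → lookup η j)

      pebble-count : Fin κ → Fin n → ℕ
      pebble-count i v = count (Tables n n) (pebbleFibre? i v)

      pebble-count-σ : ∀ i c v → pebble-count i v ≡ pebble-count i (σ D out c v)
      pebble-count-σ i c v = count-≡ (Tables n n) (Tables n n) (pebbleFibre? i v) (pebbleFibre? i (σ D out c v))
        (map (σ D out c)) (map (σ⁻¹ c)) forward backward
        (λ η _ → map-inverse (σ⁻¹-σ c) η) (λ η _ → map-inverse (σ-σ⁻¹ c) η)
        where
        forward : ∀ η → (InComponent i ∩ (λ η → lookup η j ≡ v)) η →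
          (InComponent i ∩ (λ η → lookup η j ≡ σ D out c v)) (map (σ D out c) η)
        forward η (η∈i , ηj≡v) =
          InComponent-resp-Conn η _ (map-injective η (σ-injective c) (proj₁ η∈i))
            (Conn-σ c η (proj₁ η∈i)) η∈i ,
          trans (lookup-map j _ η) (cong (σ D out c) ηj≡v)
        backward : ∀ η → (InComponent i ∩ (λ η → lookup η j ≡ σ D out c v)) η →
          (InComponent i ∩ (λ η → lookup η j ≡ v)) (map (σ⁻¹ c) η)
        backward η (η∈i , ηj≡σv) =
          InComponent-resp-Conn η _ (map-injective η (σ⁻¹-injective c) (proj₁ η∈i))
            (Conn-σ⁻¹ c η (proj₁ η∈i)) η∈i ,
          trans (lookup-map j _ η) (trans (cong (σ⁻¹ c) ηj≡σv) (σ⁻¹-σ c v))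

      pebble-count-constant : Eulerian D → ∀ i v v′ → pebble-count i v ≡ pebble-count i v′
      pebble-count-constant eulerian i = eulerian⇒arc-invariant-constant D eulerian (pebble-count i)
        λ b → trans (pebble-count-σ i (col b) (tail b)) (cong (pebble-count i) (sym (head≡σ-tail b)))

      count-InComponent≡n*pebble-count : Eulerian D → ∀ i v →
        count (Tables n n) (inComponent? i) ≡ n * pebble-count i v
      count-InComponent≡n*pebble-count eulerian i v =
        count-uniform-fibres (inComponent? i) (λ η → lookup η j) (Tables n n) (pebble-count i v)
          (λ v′ → pebble-count-constant eulerian i v′ v)

      module _ (η₀ : Vec (Fin n) n) (η₀-inj : Injective _≡_ _≡_ (lookup η₀)) (a : Fin k) where

        -- p_j⁻¹(a) ∩ A(K̃), where K̃ is the component of η₀, in decidable form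
        ArcFibre : Pred (Vec (Fin n) n × Fin m) 0ℓ
        ArcFibre (η , c) = (InComponent (component η₀) ∩ (λ η → lookup η j ≡ tail a)) η × c ≡ col a

        arcFibre? : Decidable ArcFibre
        arcFibre? (η , c) = pebbleFibre? (component η₀) (tail a) η ×-dec (c ≟ col a)

        preimage⇒ArcFibre : ∀ η c → IsVertex D out η × Conn D out η₀ η × p D out j η c ≡ a →
                            ArcFibre (η , c)
        preimage⇒ArcFibre η c (η-vertex , η₀→η , pjηc≡a) =
          (  ( proj₁ η-vertex
             , component-unique η (proj₁ η-vertex) (Conn-rep-component η₀ η₀-inj ◅◅ η₀→η))
          , trans (sym (outArc-tail _ c)) (cong tail pjηc≡a))
          , trans (sym (outArc-col _ c)) (cong col pjηc≡a)

        ArcFibre⇒preimage : ∀ η c → ArcFibre (η , c) →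
                            IsVertex D out η × Conn D out η₀ η × p D out j η c ≡ a
        ArcFibre⇒preimage η c ((η∈i₀ , ηj≡ta) , refl) =
          injective⇒bijective (proj₁ η∈i₀) ,
          EC.symmetric _ (Conn-rep-component η₀ η₀-inj) ◅◅ InComponent⇒Conn-rep η η∈i₀ ,
          outArc-unique (sym ηj≡ta) refl

        arc-count : ℕ
        arc-count = count (Finite-× (Tables n n) (Finite-Fin m)) arcFibre?

        hasCard-arc-count : HasCard {Vec (Fin n) n × Fin m}
          (λ { (η , c) → IsVertex D out η × Conn D out η₀ η × p D out j η c ≡ a }) arc-count
        hasCard-arc-count = hasCard-count (Finite-× (Tables n n) (Finite-Fin m)) arcFibre?
          (λ (η , c) → preimage⇒ArcFibre η c) (λ (η , c) → ArcFibre⇒preimage η c)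

        κ*[n*arc-count]≡n! : Eulerian D → κ * (n * arc-count) ≡ n !
        κ*[n*arc-count]≡n! eulerian = begin
          κ * (n * arc-count)                                  ≡⟨ cong (λ N → κ * (n * N)) count-ArcFibre ⟩
          κ * (n * pebble-count (component η₀) (tail a))       ≡⟨ cong (κ *_)
                                                     (count-InComponent≡n*pebble-count eulerian _ _) ⟨
          κ * count (Tables n n) (inComponent? (component η₀)) ≡⟨ κ*count-InComponent≡n! _ ⟩
          n !                                                 ∎
          where
          open ≡-Reasoning
          count-ArcFibre : arc-count ≡ pebble-count (component η₀) (tail a)
          count-ArcFibre = count-×-singleton (Tables n n) (Finite-Fin m)
                             (pebbleFibre? (component η₀) (tail a)) _≟_ (col a)

*-cancel-factorial : ∀ n N κ → κ * (suc n * N) ≡ suc n ! → N * κ ≡ n !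
*-cancel-factorial n N κ eq = *-cancelˡ-≡ (N * κ) (n !) (suc n) (trans (rearrange n N κ) eq)
  where
  rearrange : ∀ n N κ → suc n * (N * κ) ≡ κ * (suc n * N)
  rearrange = solve-∀

lemma5p2 : (n m : ℕ) (D : ColoredDigraph n m) →
    (out : OutUnique D) → InUnique D → Eulerian D →
    (κ : ℕ) → ComponentCount D out κ →
    (j : Fin n) (a : Fin (ColoredDigraph.k D)) →
    (η₀ : Vec (Fin n) n) → IsVertex D out η₀ →
    Σ ℕ λ N →
        HasCard {Vec (Fin n) n × Fin m}
          (λ { (η , c) → IsVertex D out η × Conn D out η₀ η × p D out j η c ≡ a }) N
      × N * κ ≡ (n ∸ 1) !
lemma5p2 zero _ _ _ _ _ _ _ () _ _ _
lemma5p2 (suc n) m D out in′ eulerian κ components j a η₀ η₀-vertex@(η₀-inj , _) =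
  arc-count j η₀ η₀-inj a ,
  hasCard-arc-count j η₀ η₀-inj a ,
  *-cancel-factorial n _ κ (κ*[n*arc-count]≡n! j η₀ η₀-inj a eulerian)
  where
  open Components D out in′ components (proj₁ (proj₂ (proj₂ (proj₂ components)) η₀ η₀-vertex))
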